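{- Let $\lambda$ be a nonempty Young diagram (a finite set of cells $(i,j)$, $i$ the row and $j$ the column, $i,j\geq1$, closed under moving up and left). Work over $\mathbb{Z}[x]=\mathbb{Z}[x_s:s\in\lambda]$. Let $(a,b)\notin\lambda$ be a cell of the border strip of $\lambda$, i.e. $(a,b)\notin\lambda$ and either $(a-1,b-1)\in\lambda$, or $a=1$ and $(1,b-1)\in\lambda$, or $b=1$ and $(a-1,1)\in\lambda$. Let $\lambda(i,j)=\{(u,v)\in\lambda: i\leq u,\ j\leq v\}$, $A_{ij}=F(\lambda(i,j))$, and $A(\lambda,\rho)=(A_{ij})_{1\leq i\leq a,\,1\leq j\leq b}$. Put $c=\min(a,b)$ and $U_\rho(i,k)=\{(u,v)\in\lambda: i\leq u<k\leq v+a-b\}$ ($1\leq i\leq k\leq a$), $L_\rho(l,j)=\{(u,v)\in\lambda: j\leq v<l\leq u+b-a\}$ ($1\leq j\leq l\leq b$), $d_i=\prod_{s\in\lambda(a-i+1,b-i+1)}x_s$ ($1\leq i\leq c$). Then $A(\lambda,\rho)=UDL$, where (i) $U=(U_{ik})_{1\leq i,k\leq a}$ is the upper unitriangular matrix with $U_{ik}=F(U_\rho(i,k))$ for $i\leq k$ and $0$ otherwise; (ii) $D=(D_{kl})_{1\leq k\leq a,\,1\leq l\leq b}$ with $D_{kl}=d_i$ if $(k,l)=(a-i+1,b-i+1)$ for some $1\leq i\leq c$, and $D_{kl}=0$ otherwise; (iii) $L=(L_{lj})_{1\leq l,j\leq b}$ is the lower unitriangular matrix with $L_{lj}=F(L_\rho(l,j))$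 for $j\leq l$ and $0$ otherwise.
   Context: For a finite set $S$ of cells, call $\mu\subseteq S$ an initial subshape of $S$ if whenever $(u,v)\in\mu$, $(u',v')\in S$, $u'\leq u$ and $v'\leq v$, then $(u',v')\in\mu$ (the empty set allowed). The generating function for skew shapes of $S$ is $F(S)=\sum_{\mu}\prod_{s\in S\setminus\mu}x_s$ over all initial subshapes $\mu$ of $S$; $F(\emptyset)=1$. Empty products equal $1$. ($\rho$ denotes the $a\times b$ rectangle with lower right cell $(a,b)$.) -}

module Defs where

open import Data.Nat using (ℕ; zero; suc; _+_; _∸_; _≤_; _≤ᵇ_; _≡ᵇ_; _⊓_)
open import Data.Bool using (Bool; true; false; _∧_; _∨_; not; if_then_else_)
open import Data.Product using (_×_; _,_; proj₁; proj₂)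
open import Data.Sum using (_⊎_)
open import Data.List using (List; []; _∷_; map; _++_)
open import Data.Bool.ListAction using (all; any)
open import Data.List.Membership.Propositional using (_∈_)
open import Data.List.Relation.Unary.All using (All)
open import Data.List.Relation.Unary.Unique.Propositional using (Unique)
open import Data.Fin using (Fin; toℕ)
open import Data.Maybe using (Maybe; just; nothing; maybe)
open import Relation.Binary.PropositionalEquality using (_≡_)
open import Algebra.Bundles using (CommutativeRing)

-- A cell (i , j): i = row, j = column (1-indexed).
Cell : Set
Cell = ℕ × ℕ

-- Finite sets of cells are represented by duplicate-free lists.

_≡ᶜ_ : Cell → Cell → Bool
(i , j) ≡ᶜ (k , l) = (i ≡ᵇ k) ∧ (j ≡ᵇ l)

_∈ᵇ_ : Cell → List Cell → Bool
s ∈ᵇ S = any (s ≡ᶜ_) S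

filterᶜ : (Cell → Bool) → List Cell → List Cell
filterᶜ p [] = []
filterᶜ p (s ∷ S) = if p s then s ∷ filterᶜ p S else filterᶜ p S

splits : List Cell → List (List Cell × List Cell)
splits [] = ([] , []) ∷ []
splits (s ∷ S) =
  map (λ p → (s ∷ proj₁ p , proj₂ p)) (splits S) ++ map (λ p → (proj₁ p , s ∷ proj₂ p)) (splits S)

-- μ is an initial subshape of S (μ ⊆ S is guaranteed by splits)
isInitial : List Cell → List Cell → Bool
isInitial μ S =
  all (λ c → all (λ c' → not ((proj₁ c' ≤ᵇ proj₁ c) ∧ (proj₂ c' ≤ᵇ proj₂ c)) ∨ (c' ∈ᵇ μ)) S) μ

IsYoungDiagram : List Cell → Set
IsYoungDiagram Λ =
  Unique Λ
  × All (λ c → (1 ≤ proj₁ c) × (1 ≤ proj₂ c)) Λ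
  × (∀ i j i' j' → (i , j) ∈ Λ → 1 ≤ i' → i' ≤ i → 1 ≤ j' → j' ≤ j → (i' , j') ∈ Λ)

-- (a , b) ∉ Λ is a cell of the border strip of Λ (the (a,b) ∉ Λ part is stated separately)
BorderCond : List Cell → ℕ → ℕ → Set
BorderCond Λ a b =
  ((a ∸ 1 , b ∸ 1) ∈ Λ)
  ⊎ ((a ≡ 1) × ((1 , b ∸ 1) ∈ Λ))
  ⊎ ((b ≡ 1) × ((a ∸ 1 , 1) ∈ Λ))

subΛ : List Cell → ℕ → ℕ → List Cell
subΛ Λ i j = filterᶜ (λ c → (i ≤ᵇ proj₁ c) ∧ (j ≤ᵇ proj₂ c)) Λ

-- U_ρ(i,k) = {(u,v) ∈ λ : i ≤ u < k ≤ v + a - b}   (k ≤ v+a-b  ⇔  k + b ≤ v + a)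
Uset : List Cell → ℕ → ℕ → ℕ → ℕ → List Cell
Uset Λ a b i k =
  filterᶜ (λ c → (i ≤ᵇ proj₁ c) ∧ (suc (proj₁ c) ≤ᵇ k) ∧ (k + b ≤ᵇ proj₂ c + a)) Λ

-- L_ρ(l,j) = {(u,v) ∈ λ : j ≤ v < l ≤ u + b - a}   (l ≤ u+b-a  ⇔  l + a ≤ u + b)
Lset : List Cell → ℕ → ℕ → ℕ → ℕ → List Cell
Lset Λ a b l j =
  filterᶜ (λ c → (j ≤ᵇ proj₂ c) ∧ (suc (proj₂ c) ≤ᵇ l) ∧ (l + a ≤ᵇ proj₁ c + b)) Λ

-- the index i ∈ {1..n} (if any) with (k , l) = (a - i + 1 , b - i + 1)
findDiag : ℕ → ℕ → ℕ → ℕ → ℕ → Maybe ℕ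
findDiag a b k l zero = nothing
findDiag a b k l (suc n) with findDiag a b k l n
... | just i = just i
... | nothing =
  if (k ≡ᵇ suc (a ∸ suc n)) ∧ (l ≡ᵇ suc (b ∸ suc n)) then just (suc n) else nothing

idx : ∀ {n} → Fin n → ℕ
idx i = suc (toℕ i)

module _ {c ℓ} (R : CommutativeRing c ℓ) where
  open CommutativeRing R using (Carrier; 0#; 1#) renaming (_+_ to _+R_; _*_ to _*R_)

  prodR : (Cell → Carrier) → List Cell → Carrier
  prodR x [] = 1#
  prodR x (s ∷ S) = x s *R prodR x S

  sumR : ∀ {A : Set} → (A → Carrier) → List A → Carrier
  sumR f [] = 0#
  sumR f (s ∷ S) = f s +R sumR f S

  sumFin : ∀ {n} → (Fin n → Carrier) → Carrier
  sumFin {zero} f = 0#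
  sumFin {suc n} f = f Fin.zero +R sumFin (λ i → f (Fin.suc i))

  -- F(S) = Σ_{μ initial subshape of S} Π_{s ∈ S \ μ} x_s
  F : (Cell → Carrier) → List Cell → Carrier
  F x S = sumR (λ p → if isInitial (proj₁ p) S then prodR x (proj₂ p) else 0#) (splits S)

  Amat : (Cell → Carrier) → List Cell → (a b : ℕ) → Fin a → Fin b → Carrier
  Amat x Λ a b i j = F x (subΛ Λ (idx i) (idx j))

  Umat : (Cell → Carrier) → List Cell → (a b : ℕ) → Fin a → Fin a → Carrier
  Umat x Λ a b i k = if idx i ≤ᵇ idx k then F x (Uset Λ a b (idx i) (idx k)) else 0#

  dval : (Cell → Carrier) → List Cell → (a b : ℕ) → ℕ → Carrier
  dval x Λ a b i = prodR x (subΛ Λ (suc (a ∸ i)) (suc (b ∸ i)))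

  Dmat : (Cell → Carrier) → List Cell → (a b : ℕ) → Fin a → Fin b → Carrier
  Dmat x Λ a b k l = maybe (dval x Λ a b) 0# (findDiag a b (idx k) (idx l) (a ⊓ b))

  Lmat : (Cell → Carrier) → List Cell → (a b : ℕ) → Fin b → Fin b → Carrier
  Lmat x Λ a b l j = if idx j ≤ᵇ idx l then F x (Lset Λ a b (idx l) (idx j)) else 0#

  UDL : (Cell → Carrier) → List Cell → (a b : ℕ) → Fin a → Fin b → Carrier
  UDL x Λ a b i j =
    sumFin (λ k → sumFin (λ l → (Umat x Λ a b i k *R Dmat x Λ a b k l) *R Lmat x Λ a b l j))

-- Fix an entry (I , J) and put S = λ(I,J), so A_IJ = F(S).
-- Call a splitting S = μ ⊎ ν admissible when no cell of ν is weakly north-west of a cell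
-- of μ (μ is an initial subshape); F(S) sums Π ν over admissible splittings.  For t ≥ 1
-- the row a - t and the column b - t cut the plane into quadrants NW, NE, SW, SE.
--  * Quadrant factorisation: admissible splittings with ν ∩ NW = ∅ = μ ∩ SE contribute
--    F(NE ∩ S) · F(SW ∩ S) · Π(SE ∩ S) = U_{I,a-t+1} d_t L_{b-t+1,J} =: term t.
--  * Telescoping: Φ_t sums over admissible splittings with μ ∩ SE_t = ∅.  Φ_1 = F(S) as
--    (a , b) ∉ λ.  If the corner (a - t , b - t) lies in S then Φ_t = term t + Φ_{t+1}
--    (if ν misses NW_t the corner lies in μ ∩ SE_{t+1}; otherwise admissibility forces
--    μ ∩ SE_{t+1} = ∅); if not, Φ_t = term t and all later terms vanish.
--  * D is supported on the cells (a - t + 1 , b - t + 1), so (UDL)_IJ = Σ_{t ≤ min(a,b)} term t.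

module Submission where

open import Level using (Level)
open import Algebra.Bundles using (CommutativeRing)
open import Function using (Equivalence; _⇔_; mk⇔; _∘_)
open import Data.Nat as ℕ using (ℕ; zero; suc; _∸_; _≤_; _<_; _≤?_; _≤ᵇ_; _≡ᵇ_; _⊓_; z≤n; s≤s)
open import Data.Nat.Properties as ℕₚ
  using (≤-refl; ≤-trans; ≤-pred; <⇒≤; <-≤-trans; ≤-<-trans; n≤1+n; m≤n⇒m∸n≡0; 1+n≰n; ≰⇒>; <⇒≱
        ; ≤ᵇ⇒≤; ≤⇒≤ᵇ; ≡ᵇ⇒≡; ≡⇒≡ᵇ; ∸-monoʳ-≤; +-∸-assoc
        ; m∸n≢0⇒n<m; m∸n+n≡m; +-cancelʳ-≤; +-monoˡ-≤; m≤n⊓o⇒m≤n; m≤n⊓o⇒m≤o; ⊓-glb)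
open import Data.Bool using (Bool; true; false; _∧_; not; if_then_else_; T)
open import Data.Bool.Properties using (T-∧; T-∨; T-≡; T-not-≡)
open import Data.Unit using (tt)
open import Data.Empty using (⊥; ⊥-elim)
open import Data.Product using (_×_; _,_; proj₁; proj₂; Σ-syntax)
open import Data.Sum using (_⊎_; inj₁; inj₂)
open import Data.Maybe using (just; nothing; maybe)
open import Data.List using (List; []; _∷_; map; _++_; null)
open import Data.Bool.ListAction using (all)
open import Data.List.Membership.Propositional using (_∈_; _∉_)
open import Data.List.Relation.Binary.Subset.Propositional using (_⊆_)
open import Data.List.Relation.Unary.Any using (here; there)
open import Data.List.Relation.Unary.All as All using (All; []; _∷_)
open import Data.List.Relation.Unary.All.Properties using (all⁺; all⁻)
open import Data.List.Relation.Unary.AllPairs using ([]; _∷_)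
open import Data.List.Relation.Unary.Unique.Propositional using (Unique)
open import Data.Fin using (Fin; toℕ)
open import Data.Fin.Properties using (toℕ<n; toℕ-inject₁; toℕ-fromℕ)
open import Relation.Binary.PropositionalEquality as ≡ using (_≡_; _≢_; refl)
open import Relation.Nullary using (¬_; yes; no)
open import Defs

∧-elim : ∀ {p q} → T (p ∧ q) → T p × T q
∧-elim {p} {q} = Equivalence.to (T-∧ {p} {q})

∧-intro : ∀ {p q} → T p → T q → T (p ∧ q)
∧-intro {p} {q} tp tq = Equivalence.from (T-∧ {p} {q}) (tp , tq)

not-elim : ∀ {p} → T (not p) → ¬ T p
not-elim {false} _ ()

not-intro : ∀ {p} → ¬ T p → T (not p)
not-intro {false} _ = tt
not-intro {true} ¬tp = ¬tp tt

not-not-intro : ∀ {p} → T p → T (not (not p))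
not-not-intro {true} _ = tt

T-cases : ∀ p → T p ⊎ T (not p)
T-cases true = inj₁ tt
T-cases false = inj₂ tt

T⇒≡true : ∀ {p} → T p → p ≡ true
T⇒≡true {p} = Equivalence.to (T-≡ {p})

T-not⇒≡false : ∀ {p} → T (not p) → p ≡ false
T-not⇒≡false {p} = Equivalence.to (T-not-≡ {p})

T-ext : ∀ {p q} → (T p → T q) → (T q → T p) → p ≡ q
T-ext {false} {false} _ _ = refl
T-ext {false} {true} _ q⇒p = ⊥-elim (q⇒p tt)
T-ext {true} {false} p⇒q _ = ⊥-elim (p⇒q tt)
T-ext {true} {true} _ _ = refl

maybe-if : ∀ {a b} {A : Set a} {B : Set b} (f : A → B) (z : B) p (y : A) →
  maybe f z (if p then just y else nothing) ≡ (if p then f y else z)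
maybe-if f z true y = refl
maybe-if f z false y = refl

if-T : ∀ {a} {A : Set a} {p} {y z : A} → T p → (if p then y else z) ≡ y
if-T {p = true} _ = refl

∧³-elim : ∀ {p q r} → T (p ∧ q ∧ r) → T p × T q × T r
∧³-elim {p} {q} h = let (tp , h') = ∧-elim {p} h in tp , ∧-elim {q} h'

∧³-intro : ∀ {p q r} → T p → T q → T r → T (p ∧ q ∧ r)
∧³-intro {p} {q} tp tq tr = ∧-intro {p} tp (∧-intro {q} tq tr)

∧⁴-elim : ∀ {p q r s} → T ((p ∧ q) ∧ (r ∧ s)) → T p × T q × T r × T s
∧⁴-elim {p} {q} {r} h = let (h₁ , h₂) = ∧-elim {p ∧ q} h ; (tp , tq) = ∧-elim {p} h₁ ; (tr , ts) = ∧-elim {r} h₂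
                        in tp , tq , tr , ts

∧⁴-intro : ∀ {p q r s} → T p → T q → T r → T s → T ((p ∧ q) ∧ (r ∧ s))
∧⁴-intro {p} {q} {r} tp tq tr ts = ∧-intro {p ∧ q} (∧-intro {p} tp tq) (∧-intro {r} tr ts)

≤ᵇ-false⇒> : ∀ m n → T (not (m ≤ᵇ n)) → n < m
≤ᵇ-false⇒> m n h = ≰⇒> (λ m≤n → not-elim h (≤⇒≤ᵇ m≤n))

>⇒≤ᵇ-false : ∀ m n → n < m → T (not (m ≤ᵇ n))
>⇒≤ᵇ-false m n n<m = not-intro (λ t → <⇒≱ n<m (≤ᵇ⇒≤ m n t))

≤ᵇ-false-mono : ∀ m {n n'} → n' ≤ n → T (not (m ≤ᵇ n)) → T (not (m ≤ᵇ n'))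
≤ᵇ-false-mono m {n} {n'} n'≤n h = >⇒≤ᵇ-false m n' (≤-<-trans n'≤n (≤ᵇ-false⇒> m n h))

all-elim : ∀ {A : Set} (p : A → Bool) xs → T (all p xs) → ∀ {y} → y ∈ xs → T (p y)
all-elim p xs h = All.lookup (all⁺ p xs h)

all-intro : ∀ {A : Set} (p : A → Bool) xs → (∀ {y} → y ∈ xs → T (p y)) → T (all p xs)
all-intro p xs h = all⁻ p (All.tabulate h)

≡ᶜ-sound : ∀ c d → T (c ≡ᶜ d) → c ≡ d
≡ᶜ-sound (i , j) (k , l) h with ∧-elim {i ≡ᵇ k} h
... | i≡k , j≡l = ≡.cong₂ _,_ (≡ᵇ⇒≡ i k i≡k) (≡ᵇ⇒≡ j l j≡l)

≡ᶜ-refl : ∀ c → T (c ≡ᶜ c)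
≡ᶜ-refl (i , j) = ∧-intro {i ≡ᵇ i} (≡⇒≡ᵇ i i refl) (≡⇒≡ᵇ j j refl)

∈ᵇ-sound : ∀ c L → T (c ∈ᵇ L) → c ∈ L
∈ᵇ-sound c (d ∷ L) h with T-cases (c ≡ᶜ d)
... | inj₁ c≡d = here (≡ᶜ-sound c d c≡d)
... | inj₂ c≢d rewrite T-not⇒≡false c≢d = there (∈ᵇ-sound c L h)

∈ᵇ-complete : ∀ c L → c ∈ L → T (c ∈ᵇ L)
∈ᵇ-complete c (d ∷ L) (here refl) rewrite T⇒≡true (≡ᶜ-refl c) = tt
∈ᵇ-complete c (d ∷ L) (there m) with c ≡ᶜ d
... | true = tt
... | false = ∈ᵇ-complete c L m

∁ : (Cell → Bool) → Cell → Bool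
∁ P c = not (P c)

∈-filterᶜ⁻ : ∀ p L {c} → c ∈ filterᶜ p L → c ∈ L × T (p c)
∈-filterᶜ⁻ p (s ∷ L) m with T-cases (p s)
... | inj₂ ¬ps rewrite T-not⇒≡false ¬ps = let (c∈L , pc) = ∈-filterᶜ⁻ p L m in there c∈L , pc
... | inj₁ ps rewrite T⇒≡true ps with m
...   | here refl = here refl , ps
...   | there m' = let (c∈L , pc) = ∈-filterᶜ⁻ p L m' in there c∈L , pc

∈-filterᶜ⁺ : ∀ p L {c} → c ∈ L → T (p c) → c ∈ filterᶜ p L
∈-filterᶜ⁺ p (s ∷ L) (here refl) pc rewrite T⇒≡true pc = here refl
∈-filterᶜ⁺ p (s ∷ L) (there m) pc with p s
... | true = there (∈-filterᶜ⁺ p L m pc)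
... | false = ∈-filterᶜ⁺ p L m pc

filterᶜ-⊆ : ∀ p L → filterᶜ p L ⊆ L
filterᶜ-⊆ p L m = proj₁ (∈-filterᶜ⁻ p L m)

filterᶜ-keep : ∀ p {s} L → T (p s) → filterᶜ p (s ∷ L) ≡ s ∷ filterᶜ p L
filterᶜ-keep p L ps rewrite T⇒≡true ps = refl

filterᶜ-drop : ∀ p {s} L → T (not (p s)) → filterᶜ p (s ∷ L) ≡ filterᶜ p L
filterᶜ-drop p L ¬ps rewrite T-not⇒≡false ¬ps = refl

filterᶜ-filterᶜ : ∀ p q L → filterᶜ p (filterᶜ q L) ≡ filterᶜ (λ c → q c ∧ p c) L
filterᶜ-filterᶜ p q [] = refl
filterᶜ-filterᶜ p q (s ∷ L) with q s
... | false = filterᶜ-filterᶜ p q L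
... | true with p s
...   | true = ≡.cong (s ∷_) (filterᶜ-filterᶜ p q L)
...   | false = filterᶜ-filterᶜ p q L

filterᶜ-cong : ∀ p q L → (∀ c → T (p c) → T (q c)) → (∀ c → T (q c) → T (p c)) → filterᶜ p L ≡ filterᶜ q L
filterᶜ-cong p q [] _ _ = refl
filterᶜ-cong p q (s ∷ L) p⇒q q⇒p rewrite T-ext (p⇒q s) (q⇒p s) with q s
... | true = ≡.cong (s ∷_) (filterᶜ-cong p q L p⇒q q⇒p)
... | false = filterᶜ-cong p q L p⇒q q⇒p

filterᶜ-unique : ∀ p L → Unique L → Unique (filterᶜ p L)
filterᶜ-unique p [] _ = []
filterᶜ-unique p (s ∷ L) (s∉L ∷ u) with p s
... | true = sub-All s∉L ∷ filterᶜ-unique p L u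
  where
  sub-All : ∀ {P : Cell → Set} {L'} → All P L' → All P (filterᶜ p L')
  sub-All {L' = []} [] = []
  sub-All {L' = s' ∷ L'} (h ∷ hs) with p s'
  ... | true = h ∷ sub-All hs
  ... | false = sub-All hs
... | false = filterᶜ-unique p L u

filterᶜ³ : ∀ p q r L → filterᶜ p (filterᶜ q (filterᶜ r L)) ≡ filterᶜ (λ c → r c ∧ (q c ∧ p c)) L
filterᶜ³ p q r L = ≡.trans (filterᶜ-filterᶜ p q (filterᶜ r L)) (filterᶜ-filterᶜ (λ c → q c ∧ p c) r L)

∈-filterᶜ²⁻ : ∀ p q L {c} → c ∈ filterᶜ p (filterᶜ q L) → c ∈ L × T (q c) × T (p c)
∈-filterᶜ²⁻ p q L m =
  let (m' , pc) = ∈-filterᶜ⁻ p (filterᶜ q L) m ; (c∈L , qc) = ∈-filterᶜ⁻ q L m' in c∈L , qc , pc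

∈-filterᶜ²⁺ : ∀ p q L {c} → c ∈ L → T (q c) → T (p c) → c ∈ filterᶜ p (filterᶜ q L)
∈-filterᶜ²⁺ p q L c∈L qc pc = ∈-filterᶜ⁺ p (filterᶜ q L) (∈-filterᶜ⁺ q L c∈L qc) pc

filterᶜ²-⊆ : ∀ p q L → filterᶜ p (filterᶜ q L) ⊆ L
filterᶜ²-⊆ p q L = filterᶜ-⊆ q L ∘ filterᶜ-⊆ p (filterᶜ q L)

null⁻ : ∀ (L : List Cell) {c} → T (null L) → ¬ c ∈ L
null⁻ [] _ ()

null⁺ : ∀ (L : List Cell) → (∀ {c} → ¬ c ∈ L) → T (null L)
null⁺ [] _ = tt
null⁺ (c ∷ L) h = h (here refl)

nonnull⁻ : ∀ (L : List Cell) → T (not (null L)) → Σ[ c ∈ Cell ] c ∈ L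
nonnull⁻ (c ∷ L) _ = c , here refl

nonnull⁺ : ∀ {L : List Cell} {c} → c ∈ L → T (not (null L))
nonnull⁺ (here _) = tt
nonnull⁺ (there _) = tt

null⇒≡[] : ∀ (L : List Cell) → T (null L) → L ≡ []
null⇒≡[] [] _ = refl

-- Splittings.  `Part S μ ν`: (μ , ν) is one of the splittings enumerated by `splits S`.

data Part : List Cell → List Cell → List Cell → Set where
  pnil : Part [] [] []
  intoμ : ∀ {s S μ ν} → Part S μ ν → Part (s ∷ S) (s ∷ μ) ν
  intoν : ∀ {s S μ ν} → Part S μ ν → Part (s ∷ S) μ (s ∷ ν)

Part-μ⊆S : ∀ {S μ ν} → Part S μ ν → μ ⊆ S
Part-μ⊆S (intoμ p) (here refl) = here refl
Part-μ⊆S (intoμ p) (there m) = there (Part-μ⊆S p m)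
Part-μ⊆S (intoν p) m = there (Part-μ⊆S p m)

Part-ν⊆S : ∀ {S μ ν} → Part S μ ν → ν ⊆ S
Part-ν⊆S (intoν p) (here refl) = here refl
Part-ν⊆S (intoν p) (there m) = there (Part-ν⊆S p m)
Part-ν⊆S (intoμ p) m = there (Part-ν⊆S p m)

Part-cover : ∀ {S μ ν c} → Part S μ ν → c ∈ S → c ∈ μ ⊎ c ∈ ν
Part-cover (intoμ p) (here refl) = inj₁ (here refl)
Part-cover (intoν p) (here refl) = inj₂ (here refl)
Part-cover (intoμ p) (there m) with Part-cover p m
... | inj₁ c∈μ = inj₁ (there c∈μ)
... | inj₂ c∈ν = inj₂ c∈ν
Part-cover (intoν p) (there m) with Part-cover p m
... | inj₁ c∈μ = inj₁ c∈μ
... | inj₂ c∈ν = inj₂ (there c∈ν)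

Part-disjoint : ∀ {S μ ν c} → Part S μ ν → Unique S → c ∈ μ → c ∈ ν → ⊥
Part-disjoint (intoμ p) (s∉S ∷ _) (here refl) c∈ν = All.lookup s∉S (Part-ν⊆S p c∈ν) refl
Part-disjoint (intoμ p) (_ ∷ u) (there c∈μ) c∈ν = Part-disjoint p u c∈μ c∈ν
Part-disjoint (intoν p) (s∉S ∷ _) c∈μ (here refl) = All.lookup s∉S (Part-μ⊆S p c∈μ) refl
Part-disjoint (intoν p) (_ ∷ u) c∈μ (there c∈ν) = Part-disjoint p u c∈μ c∈ν

_≼ᵇ_ : Cell → Cell → Bool
c' ≼ᵇ c = (proj₁ c' ≤ᵇ proj₁ c) ∧ (proj₂ c' ≤ᵇ proj₂ c)

≼ᵇ-rows : ∀ c' c → T (c' ≼ᵇ c) → proj₁ c' ≤ proj₁ c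
≼ᵇ-rows c' c h = ≤ᵇ⇒≤ (proj₁ c') (proj₁ c) (proj₁ (∧-elim {proj₁ c' ≤ᵇ proj₁ c} h))

≼ᵇ-cols : ∀ c' c → T (c' ≼ᵇ c) → proj₂ c' ≤ proj₂ c
≼ᵇ-cols c' c h = ≤ᵇ⇒≤ (proj₂ c') (proj₂ c) (proj₂ (∧-elim {proj₁ c' ≤ᵇ proj₁ c} h))

≼ᵇ-intro : ∀ c' c → proj₁ c' ≤ proj₁ c → proj₂ c' ≤ proj₂ c → T (c' ≼ᵇ c)
≼ᵇ-intro c' c u'≤u v'≤v = ∧-intro {proj₁ c' ≤ᵇ proj₁ c} (≤⇒≤ᵇ u'≤u) (≤⇒≤ᵇ v'≤v)

admissible : List Cell → List Cell → Bool
admissible μ ν = all (λ c → all (λ c' → not (c' ≼ᵇ c)) ν) μ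

admissible-elim : ∀ μ ν → T (admissible μ ν) → ∀ {c c'} → c ∈ μ → c' ∈ ν → ¬ T (c' ≼ᵇ c)
admissible-elim μ ν h c∈μ c'∈ν = not-elim (all-elim _ ν (all-elim _ μ h c∈μ) c'∈ν)

admissible-intro : ∀ μ ν → (∀ {c c'} → c ∈ μ → c' ∈ ν → ¬ T (c' ≼ᵇ c)) → T (admissible μ ν)
admissible-intro μ ν h = all-intro _ μ (λ c∈μ → all-intro _ ν (λ c'∈ν → not-intro (h c∈μ c'∈ν)))

admissible-⊆ : ∀ {μ ν μ' ν'} → μ' ⊆ μ → ν' ⊆ ν → T (admissible μ ν) → T (admissible μ' ν')
admissible-⊆ {μ} {ν} {μ'} {ν'} μ'⊆μ ν'⊆ν h =
  admissible-intro μ' ν' (λ c∈μ' c'∈ν' → admissible-elim μ ν h (μ'⊆μ c∈μ') (ν'⊆ν c'∈ν'))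

isInitial≡admissible : ∀ {S μ ν} → Part S μ ν → Unique S → isInitial μ S ≡ admissible μ ν
isInitial≡admissible {S} {μ} {ν} p u = T-ext initial⇒admissible admissible⇒initial
  where
  initial⇒admissible : T (isInitial μ S) → T (admissible μ ν)
  initial⇒admissible h = admissible-intro μ ν λ {c} {c'} c∈μ c'∈ν c'≼c →
    case-∨ (Equivalence.to T-∨ (all-elim _ S (all-elim _ μ h c∈μ) (Part-ν⊆S p c'∈ν))) c'≼c c'∈ν
    where
    case-∨ : ∀ {c c'} → T (not (c' ≼ᵇ c)) ⊎ T (c' ∈ᵇ μ) → T (c' ≼ᵇ c) → c' ∈ ν → ⊥
    case-∨ (inj₁ c'⋠c) c'≼c _ = not-elim c'⋠c c'≼c
    case-∨ {c' = c'} (inj₂ c'∈ᵇμ) _ c'∈ν = Part-disjoint p u (∈ᵇ-sound c' μ c'∈ᵇμ) c'∈ν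
  admissible⇒initial : T (admissible μ ν) → T (isInitial μ S)
  admissible⇒initial h = all-intro _ μ λ {c} c∈μ → all-intro _ S λ {c'} c'∈S →
    Equivalence.from T-∨ (closed c∈μ (Part-cover p c'∈S))
    where
    closed : ∀ {c c'} → c ∈ μ → c' ∈ μ ⊎ c' ∈ ν → T (not (c' ≼ᵇ c)) ⊎ T (c' ∈ᵇ μ)
    closed _ (inj₁ c'∈μ) = inj₂ (∈ᵇ-complete _ μ c'∈μ)
    closed c∈μ (inj₂ c'∈ν) = inj₁ (not-intro (admissible-elim μ ν h c∈μ c'∈ν))

DownClosed : (Cell → Bool) → Set
DownClosed P = ∀ c' c → T (c' ≼ᵇ c) → T (P c) → T (P c')

∁-upClosed : ∀ {P} → DownClosed P → ∀ c' c → T (c' ≼ᵇ c) → T (∁ P c') → T (∁ P c)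
∁-upClosed P↓ c' c c'≼c ¬Pc' = not-intro (λ Pc → not-elim ¬Pc' (P↓ c' c c'≼c Pc))

module Quadrants (top left : Cell → Bool) where

  NW NE SW SE : List Cell → List Cell
  NW L = filterᶜ left (filterᶜ top L)
  NE L = filterᶜ (∁ left) (filterᶜ top L)
  SW L = filterᶜ left (filterᶜ (∁ top) L)
  SE L = filterᶜ (∁ left) (filterᶜ (∁ top) L)

  -- For down-closed top and left, once ν misses NW and μ misses SE, admissibility
  -- only constrains the NE and SW parts; NE and SW cells are mutually incomparable,
  -- so the constraint splits into two independent ones.
  admissible-quadrants : DownClosed top → DownClosed left → ∀ μ ν →
    T (null (NW ν)) → T (null (SE μ)) →
    admissible μ ν ≡ admissible (NE μ) (NE ν) ∧ admissible (SW μ) (SW ν)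
  admissible-quadrants top↓ left↓ μ ν nw se = T-ext split-parts combine
    where
    split-parts : T (admissible μ ν) → T (admissible (NE μ) (NE ν) ∧ admissible (SW μ) (SW ν))
    split-parts h = ∧-intro {admissible (NE μ) (NE ν)}
      (admissible-⊆ (filterᶜ²-⊆ _ _ μ) (filterᶜ²-⊆ _ _ ν) h)
      (admissible-⊆ (filterᶜ²-⊆ _ _ μ) (filterᶜ²-⊆ _ _ ν) h)
    not-SE : ∀ {c} → c ∈ μ → T (∁ top c) → T (∁ left c) → ⊥
    not-SE c∈μ ¬t ¬l = null⁻ (SE μ) se (∈-filterᶜ²⁺ (∁ left) (∁ top) μ c∈μ ¬t ¬l)
    no-conflict : T (admissible (NE μ) (NE ν)) → T (admissible (SW μ) (SW ν)) →
                  ∀ {c c'} → c ∈ μ → c' ∈ ν → ¬ T (c' ≼ᵇ c)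
    no-conflict ne sw {c} {c'} c∈μ c'∈ν c'≼c with T-cases (top c') | T-cases (left c')
    ... | inj₁ t' | inj₁ l' = null⁻ (NW ν) nw (∈-filterᶜ²⁺ left top ν c'∈ν t' l')
    ... | inj₁ t' | inj₂ ¬l' with T-cases (top c)
    ...   | inj₁ t = admissible-elim _ _ ne (∈-filterᶜ²⁺ _ _ μ c∈μ t (∁-upClosed left↓ c' c c'≼c ¬l'))
                                           (∈-filterᶜ²⁺ _ _ ν c'∈ν t' ¬l') c'≼c
    ...   | inj₂ ¬t = not-SE c∈μ ¬t (∁-upClosed left↓ c' c c'≼c ¬l')
    no-conflict ne sw {c} {c'} c∈μ c'∈ν c'≼c | inj₂ ¬t' | inj₁ l' with T-cases (left c)
    ...   | inj₁ l = admissible-elim _ _ sw (∈-filterᶜ²⁺ _ _ μ c∈μ (∁-upClosed top↓ c' c c'≼c ¬t') l)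
                                           (∈-filterᶜ²⁺ _ _ ν c'∈ν ¬t' l') c'≼c
    ...   | inj₂ ¬l = not-SE c∈μ (∁-upClosed top↓ c' c c'≼c ¬t') ¬l
    no-conflict ne sw {c} {c'} c∈μ c'∈ν c'≼c | inj₂ ¬t' | inj₂ ¬l' =
      not-SE c∈μ (∁-upClosed top↓ c' c c'≼c ¬t') (∁-upClosed left↓ c' c c'≼c ¬l')
    combine : T (admissible (NE μ) (NE ν) ∧ admissible (SW μ) (SW ν)) → T (admissible μ ν)
    combine h = let (ne , sw) = ∧-elim {admissible (NE μ) (NE ν)} h in admissible-intro μ ν (no-conflict ne sw)

module SplittingSums {ℓ₁ ℓ₂} (R : CommutativeRing ℓ₁ ℓ₂) (x : Cell → CommutativeRing.Carrier R) where
  open CommutativeRing R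
    renaming (refl to ≈-refl; sym to ≈-sym; trans to ≈-trans; reflexive to ≈-reflexive)
  open import Relation.Binary.Reasoning.Setoid setoid
  open import Algebra.Properties.CommutativeSemigroup +-commutativeSemigroup
    using () renaming (interchange to +-interchange)

  Splitting : Set
  Splitting = List Cell × List Cell

  Σs : List Cell → (Splitting → Carrier) → Carrier
  Σs S f = sumR R f (splits S)

  Π : List Cell → Carrier
  Π = prodR R x

  sumR-cong : ∀ {A : Set} {f g : A → Carrier} xs → (∀ a → f a ≈ g a) → sumR R f xs ≈ sumR R g xs
  sumR-cong [] _ = ≈-refl
  sumR-cong (a ∷ xs) f≈g = +-cong (f≈g a) (sumR-cong xs f≈g)

  sumR-++ : ∀ {A : Set} (f : A → Carrier) xs ys → sumR R f (xs ++ ys) ≈ sumR R f xs + sumR R f ys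
  sumR-++ f [] ys = ≈-sym (+-identityˡ _)
  sumR-++ f (a ∷ xs) ys = ≈-trans (+-congˡ (sumR-++ f xs ys)) (≈-sym (+-assoc _ _ _))

  sumR-map : ∀ {A B : Set} (f : B → Carrier) (g : A → B) xs → sumR R f (map g xs) ≡ sumR R (f ∘ g) xs
  sumR-map f g [] = refl
  sumR-map f g (a ∷ xs) = ≡.cong (f (g a) +_) (sumR-map f g xs)

  sumR-+ : ∀ {A : Set} (f g : A → Carrier) xs → sumR R (λ a → f a + g a) xs ≈ sumR R f xs + sumR R g xs
  sumR-+ f g [] = ≈-sym (+-identityˡ _)
  sumR-+ f g (a ∷ xs) = ≈-trans (+-congˡ (sumR-+ f g xs)) (+-interchange _ _ _ _)

  sumR-*ˡ : ∀ {A : Set} (k : Carrier) (f : A → Carrier) xs → sumR R (λ a → k * f a) xs ≈ k * sumR R f xs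
  sumR-*ˡ k f [] = ≈-sym (zeroʳ k)
  sumR-*ˡ k f (a ∷ xs) = ≈-trans (+-congˡ (sumR-*ˡ k f xs)) (≈-sym (distribˡ k _ _))

  sumR-0 : ∀ {A : Set} xs → sumR R (λ (_ : A) → 0#) xs ≈ 0#
  sumR-0 [] = ≈-refl
  sumR-0 (a ∷ xs) = ≈-trans (+-identityˡ _) (sumR-0 xs)

  putμ putν : Cell → Splitting → Splitting
  putμ s p = s ∷ proj₁ p , proj₂ p
  putν s p = proj₁ p , s ∷ proj₂ p

  Σs-cons : ∀ s S f → Σs (s ∷ S) f ≈ Σs S (f ∘ putμ s) + Σs S (f ∘ putν s)
  Σs-cons s S f = ≈-trans (sumR-++ f (map (putμ s) (splits S)) (map (putν s) (splits S)))
    (≈-reflexive (≡.cong₂ _+_ (sumR-map f (putμ s) (splits S)) (sumR-map f (putν s) (splits S))))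

  Σs-cong : ∀ S {f g} → (∀ p → f p ≈ g p) → Σs S f ≈ Σs S g
  Σs-cong S = sumR-cong (splits S)

  Σs-cong-Part : ∀ S {f g} → (∀ {μ ν} → Part S μ ν → f (μ , ν) ≈ g (μ , ν)) → Σs S f ≈ Σs S g
  Σs-cong-Part [] f≈g = +-cong (f≈g pnil) ≈-refl
  Σs-cong-Part (s ∷ S) {f} {g} f≈g = begin
    Σs (s ∷ S) f                          ≈⟨ Σs-cons s S f ⟩
    Σs S (f ∘ putμ s) + Σs S (f ∘ putν s) ≈⟨ +-cong (Σs-cong-Part S (f≈g ∘ intoμ)) (Σs-cong-Part S (f≈g ∘ intoν)) ⟩
    Σs S (g ∘ putμ s) + Σs S (g ∘ putν s) ≈⟨ Σs-cons s S g ⟨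
    Σs (s ∷ S) g                          ∎

  restrict : (Cell → Bool) → Splitting → Splitting
  restrict κ p = filterᶜ κ (proj₁ p) , filterᶜ κ (proj₂ p)

  module _ (κ : Cell → Bool) {s : Cell} (p : Splitting) where
    restrict-putμ-keep : T (κ s) → restrict κ (putμ s p) ≡ putμ s (restrict κ p)
    restrict-putμ-keep κs = ≡.cong (_, filterᶜ κ (proj₂ p)) (filterᶜ-keep κ (proj₁ p) κs)

    restrict-putν-keep : T (κ s) → restrict κ (putν s p) ≡ putν s (restrict κ p)
    restrict-putν-keep κs = ≡.cong (filterᶜ κ (proj₁ p) ,_) (filterᶜ-keep κ (proj₂ p) κs)

    restrict-putμ-drop : T (not (κ s)) → restrict κ (putμ s p) ≡ restrict κ p
    restrict-putμ-drop ¬κs = ≡.cong (_, filterᶜ κ (proj₂ p)) (filterᶜ-drop κ (proj₁ p) ¬κs)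

    restrict-putν-drop : T (not (κ s)) → restrict κ (putν s p) ≡ restrict κ p
    restrict-putν-drop ¬κs = ≡.cong (filterᶜ κ (proj₁ p) ,_) (filterᶜ-drop κ (proj₂ p) ¬κs)

  -- A splitting of S is the same as a splitting of its κ-part together with one of
  -- its (∁ κ)-part, so weights that are products over the two parts factorise.
  Σs-factorise : ∀ κ S (g h : Splitting → Carrier) →
    Σs S (λ p → g (restrict κ p) * h (restrict (∁ κ) p)) ≈ Σs (filterᶜ κ S) g * Σs (filterᶜ (∁ κ) S) h
  Σs-factorise κ [] g h = begin
    g ([] , []) * h ([] , []) + 0#          ≈⟨ +-identityʳ _ ⟩
    g ([] , []) * h ([] , [])               ≈⟨ *-cong (+-identityʳ _) (+-identityʳ _) ⟨
    (g ([] , []) + 0#) * (h ([] , []) + 0#) ∎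
  Σs-factorise κ (s ∷ S) g h = sort-s (T-cases (κ s))
    where
    w = λ p → g (restrict κ p) * h (restrict (∁ κ) p)
    κS = filterᶜ κ S
    ∁κS = filterᶜ (∁ κ) S
    sort-s : T (κ s) ⊎ T (not (κ s)) → Σs (s ∷ S) w ≈ Σs (filterᶜ κ (s ∷ S)) g * Σs (filterᶜ (∁ κ) (s ∷ S)) h
    sort-s (inj₁ κs) = begin
      Σs (s ∷ S) w                                      ≈⟨ Σs-cons s S w ⟩
      Σs S (w ∘ putμ s) + Σs S (w ∘ putν s)             ≈⟨ +-cong (Σs-cong S (λ p → ≈-reflexive (≡.cong₂ (λ A B → g A * h B)
                                                            (restrict-putμ-keep κ p κs) (restrict-putμ-drop (∁ κ) p (not-not-intro κs)))))
                                                                  (Σs-cong S (λ p → ≈-reflexive (≡.cong₂ (λ A B → g A * h B)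
                                                            (restrict-putν-keep κ p κs) (restrict-putν-drop (∁ κ) p (not-not-intro κs))))) ⟩
      Σs S (λ p → g (putμ s (restrict κ p)) * h (restrict (∁ κ) p))
        + Σs S (λ p → g (putν s (restrict κ p)) * h (restrict (∁ κ) p))
                                                        ≈⟨ +-cong (Σs-factorise κ S (g ∘ putμ s) h) (Σs-factorise κ S (g ∘ putν s) h) ⟩
      Σs κS (g ∘ putμ s) * Σs ∁κS h + Σs κS (g ∘ putν s) * Σs ∁κS h
                                                        ≈⟨ distribʳ _ _ _ ⟨
      (Σs κS (g ∘ putμ s) + Σs κS (g ∘ putν s)) * Σs ∁κS h ≈⟨ *-congʳ (Σs-cons s κS g) ⟨
      Σs (s ∷ κS) g * Σs ∁κS h                          ≡⟨ ≡.cong₂ (λ A B → Σs A g * Σs B h)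
                                                            (filterᶜ-keep κ S κs) (filterᶜ-drop (∁ κ) S (not-not-intro κs)) ⟨
      Σs (filterᶜ κ (s ∷ S)) g * Σs (filterᶜ (∁ κ) (s ∷ S)) h ∎
    sort-s (inj₂ ¬κs) = begin
      Σs (s ∷ S) w                                      ≈⟨ Σs-cons s S w ⟩
      Σs S (w ∘ putμ s) + Σs S (w ∘ putν s)             ≈⟨ +-cong (Σs-cong S (λ p → ≈-reflexive (≡.cong₂ (λ A B → g A * h B)
                                                            (restrict-putμ-drop κ p ¬κs) (restrict-putμ-keep (∁ κ) p ¬κs))))
                                                                  (Σs-cong S (λ p → ≈-reflexive (≡.cong₂ (λ A B → g A * h B)
                                                            (restrict-putν-drop κ p ¬κs) (restrict-putν-keep (∁ κ) p ¬κs)))) ⟩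
      Σs S (λ p → g (restrict κ p) * h (putμ s (restrict (∁ κ) p)))
        + Σs S (λ p → g (restrict κ p) * h (putν s (restrict (∁ κ) p)))
                                                        ≈⟨ +-cong (Σs-factorise κ S g (h ∘ putμ s)) (Σs-factorise κ S g (h ∘ putν s)) ⟩
      Σs κS g * Σs ∁κS (h ∘ putμ s) + Σs κS g * Σs ∁κS (h ∘ putν s)
                                                        ≈⟨ distribˡ _ _ _ ⟨
      Σs κS g * (Σs ∁κS (h ∘ putμ s) + Σs ∁κS (h ∘ putν s)) ≈⟨ *-congˡ (Σs-cons s ∁κS h) ⟨
      Σs κS g * Σs (s ∷ ∁κS) h                          ≡⟨ ≡.cong₂ (λ A B → Σs A g * Σs B h)
                                                            (filterᶜ-drop κ S ¬κs) (filterᶜ-keep (∁ κ) S ¬κs) ⟨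
      Σs (filterᶜ κ (s ∷ S)) g * Σs (filterᶜ (∁ κ) (s ∷ S)) h ∎

  Π-split : ∀ κ L → Π L ≈ Π (filterᶜ κ L) * Π (filterᶜ (∁ κ) L)
  Π-split κ [] = ≈-sym (*-identityˡ _)
  Π-split κ (s ∷ L) with κ s
  ... | true = ≈-trans (*-congˡ (Π-split κ L)) (≈-sym (*-assoc _ _ _))
  ... | false = begin
    x s * Π L                                          ≈⟨ *-congˡ (Π-split κ L) ⟩
    x s * (Π (filterᶜ κ L) * Π (filterᶜ (∁ κ) L))      ≈⟨ x∙yz≈y∙xz _ _ _ ⟩
    Π (filterᶜ κ L) * (x s * Π (filterᶜ (∁ κ) L))      ∎
    where open import Algebra.Properties.CommutativeSemigroup *-commutativeSemigroup using (x∙yz≈y∙xz)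

  Σs-ν-empty : ∀ L → Σs L (λ p → if null (proj₂ p) then 1# else 0#) ≈ 1#
  Σs-ν-empty [] = +-identityʳ _
  Σs-ν-empty (s ∷ L) = ≈-trans (Σs-cons s L _)
    (≈-trans (+-cong (Σs-ν-empty L) (sumR-0 (splits L))) (+-identityʳ _))

  Σs-μ-empty : ∀ L → Σs L (λ p → if null (proj₁ p) then Π (proj₂ p) else 0#) ≈ Π L
  Σs-μ-empty [] = +-identityʳ _
  Σs-μ-empty (s ∷ L) = begin
    Σs (s ∷ L) w                                      ≈⟨ Σs-cons s L w ⟩
    Σs L (w ∘ putμ s) + Σs L (w ∘ putν s)             ≈⟨ +-cong (sumR-0 (splits L)) (Σs-cong L (λ p → pull (null (proj₁ p)))) ⟩
    0# + Σs L (λ p → x s * w p)                       ≈⟨ +-identityˡ _ ⟩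
    Σs L (λ p → x s * w p)                            ≈⟨ sumR-*ˡ (x s) w (splits L) ⟩
    x s * Σs L w                                      ≈⟨ *-congˡ (Σs-μ-empty L) ⟩
    x s * Π L                                         ∎
    where
    w = λ p → if null (proj₁ p) then Π (proj₂ p) else 0#
    pull : ∀ {y} b → (if b then x s * y else 0#) ≈ x s * (if b then y else 0#)
    pull true = ≈-refl
    pull false = ≈-sym (zeroʳ _)

  admissibleWeight : Splitting → Carrier
  admissibleWeight p = if admissible (proj₁ p) (proj₂ p) then Π (proj₂ p) else 0#

  F-admissible : ∀ S → Unique S → F R x S ≈ Σs S admissibleWeight
  F-admissible S u = Σs-cong-Part S λ {μ} {ν} p →
    ≈-reflexive (≡.cong (λ b → if b then Π ν else 0#) (isInitial≡admissible p u))

  module QuadrantSums (top left : Cell → Bool) (top↓ : DownClosed top) (left↓ : DownClosed left) where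
    open Quadrants top left public

    quadrantWeight : Splitting → Carrier
    quadrantWeight p =
      if null (NW (proj₂ p)) ∧ null (SE (proj₁ p)) ∧ admissible (proj₁ p) (proj₂ p) then Π (proj₂ p) else 0#

    private
      νEmpty μEmpty : Splitting → Carrier
      νEmpty p = if null (proj₂ p) then 1# else 0#
      μEmpty p = if null (proj₁ p) then Π (proj₂ p) else 0#

      topFactor bottomFactor : Splitting → Carrier
      topFactor q = νEmpty (restrict left q) * admissibleWeight (restrict (∁ left) q)
      bottomFactor q = admissibleWeight (restrict left q) * μEmpty (restrict (∁ left) q)

    -- Pointwise, the weight is a product of independent conditions on the four quadrants
    -- (by admissible-quadrants), the monomial splitting accordingly.
    quadrantWeight-factors : ∀ p → quadrantWeight p ≈ topFactor (restrict top p) * bottomFactor (restrict (∁ top) p)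
    quadrantWeight-factors (μ , ν) with T-cases (null (NW ν)) | T-cases (null (SE μ))
    ... | inj₂ nw≢[] | _ rewrite T-not⇒≡false nw≢[] = ≈-sym (≈-trans (*-congʳ (zeroˡ _)) (zeroˡ _))
    ... | inj₁ nw | inj₂ se≢[] rewrite T⇒≡true nw | T-not⇒≡false se≢[] = ≈-sym (≈-trans (*-congˡ (zeroʳ _)) (zeroʳ _))
    ... | inj₁ nw | inj₁ se rewrite T⇒≡true nw | T⇒≡true se | admissible-quadrants top↓ left↓ μ ν nw se
      with admissible (NE μ) (NE ν) | admissible (SW μ) (SW ν)
    ...   | false | _ = ≈-sym (≈-trans (*-congʳ (zeroʳ _)) (zeroˡ _))
    ...   | true | false = ≈-sym (≈-trans (*-congˡ (zeroˡ _)) (zeroʳ _))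
    ...   | true | true = begin
      Π ν
        ≈⟨ Π-split top ν ⟩
      Π (filterᶜ top ν) * Π (filterᶜ (∁ top) ν)
        ≈⟨ *-cong (Π-split left (filterᶜ top ν)) (Π-split left (filterᶜ (∁ top) ν)) ⟩
      (Π (NW ν) * Π (NE ν)) * (Π (SW ν) * Π (SE ν))
        ≡⟨ ≡.cong (λ L → (Π L * Π (NE ν)) * (Π (SW ν) * Π (SE ν))) (null⇒≡[] (NW ν) nw) ⟩
      (1# * Π (NE ν)) * (Π (SW ν) * Π (SE ν))
        ∎

    quadrant-factorisation : ∀ S → Unique S → Σs S quadrantWeight ≈ F R x (NE S) * (F R x (SW S) * Π (SE S))
    quadrant-factorisation S u = begin
      Σs S quadrantWeight
        ≈⟨ Σs-cong S quadrantWeight-factors ⟩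
      Σs S (λ p → topFactor (restrict top p) * bottomFactor (restrict (∁ top) p))
        ≈⟨ Σs-factorise top S topFactor bottomFactor ⟩
      Σs (filterᶜ top S) topFactor * Σs (filterᶜ (∁ top) S) bottomFactor
        ≈⟨ *-cong (Σs-factorise left (filterᶜ top S) νEmpty admissibleWeight)
                  (Σs-factorise left (filterᶜ (∁ top) S) admissibleWeight μEmpty) ⟩
      (Σs (NW S) νEmpty * Σs (NE S) admissibleWeight) * (Σs (SW S) admissibleWeight * Σs (SE S) μEmpty)
        ≈⟨ *-cong (*-cong (Σs-ν-empty (NW S)) (≈-sym (F-admissible (NE S) unique²)))
                  (*-cong (≈-sym (F-admissible (SW S) unique²)) (Σs-μ-empty (SE S))) ⟩
      (1# * F R x (NE S)) * (F R x (SW S) * Π (SE S))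
        ≈⟨ *-congʳ (*-identityˡ _) ⟩
      F R x (NE S) * (F R x (SW S) * Π (SE S))
        ∎
      where
      unique² : ∀ {p q} → Unique (filterᶜ p (filterᶜ q S))
      unique² {p} {q} = filterᶜ-unique p _ (filterᶜ-unique q S u)

∸-suc : ∀ {a t} → t < a → a ∸ t ≡ suc (a ∸ suc t)
∸-suc t<a = +-∸-assoc 1 t<a

∸-pos⇒< : ∀ {a t} → 1 ≤ a ∸ t → t < a
∸-pos⇒< h = m∸n≢0⇒n<m (λ eq → 1+n≰n (≡.subst (1 ≤_) eq h))

-- Corners further down the diagonal lie strictly south-east.
∸-step : ∀ {a t r} → t < r → r ≤ a → suc (a ∸ r) ≤ a ∸ t
∸-step {a} {t} {r} t<r r≤a = ≡.subst (suc (a ∸ r) ≤_) (≡.sym (∸-suc (<-≤-trans t<r r≤a))) (s≤s (∸-monoʳ-≤ a t<r))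

-- The corners (a - t + 1 , b - t + 1) all lie on one diagonal: (a - t) + b = (b - t) + a.
diagonal-shift : ∀ {a b t} → t ≤ a → t ≤ b → (a ∸ t) ℕ.+ b ≡ (b ∸ t) ℕ.+ a
diagonal-shift {a} {b} {t} t≤a t≤b = begin
  (a ∸ t) ℕ.+ b                  ≡⟨ ≡.cong ((a ∸ t) ℕ.+_) (m∸n+n≡m t≤b) ⟨
  (a ∸ t) ℕ.+ ((b ∸ t) ℕ.+ t)    ≡⟨ x∙yz≈y∙xz (a ∸ t) (b ∸ t) t ⟩
  (b ∸ t) ℕ.+ ((a ∸ t) ℕ.+ t)    ≡⟨ ≡.cong ((b ∸ t) ℕ.+_) (m∸n+n≡m t≤a) ⟩
  (b ∸ t) ℕ.+ a                  ∎
  where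
  open ≡.≡-Reasoning
  open import Algebra.Properties.CommutativeSemigroup ℕₚ.+-commutativeSemigroup using (x∙yz≈y∙xz)

-- Hence the condition k ≤ v + a - b of U_ρ, at k = a - t + 1, says v ≥ b - t + 1.
diagonal-≤ : ∀ {a b t} v → t ≤ a → t ≤ b → (suc (a ∸ t) ℕ.+ b ≤ v ℕ.+ a) ⇔ (suc (b ∸ t) ≤ v)
diagonal-≤ {a} {b} {t} v t≤a t≤b = mk⇔
  (λ h → +-cancelʳ-≤ a (suc (b ∸ t)) v (≡.subst (_≤ v ℕ.+ a) shift h))
  (λ h → ≡.subst (_≤ v ℕ.+ a) (≡.sym shift) (+-monoˡ-≤ a h))
  where
  shift : suc (a ∸ t) ℕ.+ b ≡ suc (b ∸ t) ℕ.+ a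
  shift = ≡.cong suc (diagonal-shift t≤a t≤b)

module IndexSums {ℓ₁ ℓ₂} (R : CommutativeRing ℓ₁ ℓ₂) where
  open CommutativeRing R
    renaming (refl to ≈-refl; sym to ≈-sym; trans to ≈-trans; reflexive to ≈-reflexive)
  open import Algebra.Properties.Semiring.Sum semiring
    using (sum; sum-cong-≋; sum-cong-≗; sum-replicate-zero; sum-init-last; ∑-comm; *-distribˡ-sum; *-distribʳ-sum)

  ∑< : ℕ → (ℕ → Carrier) → Carrier
  ∑< n h = sum {n} (h ∘ toℕ)

  sumFin≡∑< : ∀ n (h : ℕ → Carrier) → sumFin R {n} (h ∘ toℕ) ≡ ∑< n h
  sumFin≡∑< zero h = refl
  sumFin≡∑< (suc n) h = ≡.cong (h 0 +_) (sumFin≡∑< n (h ∘ suc))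

  sumFin²≡∑<² : ∀ m n (h : ℕ → ℕ → Carrier) →
    sumFin R {m} (λ k → sumFin R {n} (λ l → h (toℕ k) (toℕ l))) ≡ ∑< m (λ k → ∑< n (h k))
  sumFin²≡∑<² m n h = ≡.trans (sumFin≡∑< m (λ k → sumFin R {n} (λ l → h k (toℕ l))))
                              (sum-cong-≗ {m} (λ k → sumFin≡∑< n (h (toℕ k))))

  ∑<-cong : ∀ n {f g : ℕ → Carrier} → (∀ k → k < n → f k ≈ g k) → ∑< n f ≈ ∑< n g
  ∑<-cong n f≈g = sum-cong-≋ (λ k → f≈g (toℕ k) (toℕ<n k))

  ∑<-zero : ∀ n {f : ℕ → Carrier} → (∀ k → k < n → f k ≈ 0#) → ∑< n f ≈ 0#
  ∑<-zero n f≈0 = ≈-trans (∑<-cong n f≈0) (sum-replicate-zero n)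

  ∑<-snoc : ∀ n (h : ℕ → Carrier) → ∑< (suc n) h ≈ ∑< n h + h n
  ∑<-snoc n h = ≈-trans (sum-init-last {n} (h ∘ toℕ))
    (+-cong (≈-reflexive (sum-cong-≗ {n} (λ k → ≡.cong h (toℕ-inject₁ k)))) (≈-reflexive (≡.cong h (toℕ-fromℕ n))))

  ∑<-comm : ∀ m n (f : ℕ → ℕ → Carrier) → ∑< m (λ k → ∑< n (f k)) ≈ ∑< n (λ l → ∑< m (λ k → f k l))
  ∑<-comm m n f = ∑-comm {m} {n} (λ k l → f (toℕ k) (toℕ l))

  ∑<-*ˡ : ∀ n y (f : ℕ → Carrier) → y * ∑< n f ≈ ∑< n (λ k → y * f k)
  ∑<-*ˡ n y f = *-distribˡ-sum {n} y (f ∘ toℕ)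

  ∑<-*ʳ : ∀ n y (f : ℕ → Carrier) → ∑< n f * y ≈ ∑< n (λ k → f k * y)
  ∑<-*ʳ n y f = *-distribʳ-sum {n} y (f ∘ toℕ)

  ∑<-if : ∀ n p (g : ℕ → Carrier) → ∑< n (λ k → if p then g k else 0#) ≈ (if p then ∑< n g else 0#)
  ∑<-if n true g = ≈-refl
  ∑<-if n false g = ∑<-zero n (λ _ _ → ≈-refl)

  ∑<-δ : ∀ n (g : ℕ → Carrier) K → K < n → ∑< n (λ k → if k ≡ᵇ K then g k else 0#) ≈ g K
  ∑<-δ (suc n) g zero _ = ≈-trans (+-congˡ (∑<-zero n (λ _ _ → ≈-refl))) (+-identityʳ _)
  ∑<-δ (suc n) g (suc K) (s≤s K<n) = ≈-trans (+-identityˡ _) (∑<-δ n (g ∘ suc) K K<n)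

module Terms {ℓ₁ ℓ₂} (R : CommutativeRing ℓ₁ ℓ₂) (x : Cell → CommutativeRing.Carrier R)
  (Λ : List Cell) (a b I J : ℕ) where
  open CommutativeRing R using (Carrier; 0#; _*_)

  Uentry Lentry : ℕ → Carrier
  Uentry K = if I ≤ᵇ K then F R x (Uset Λ a b I K) else 0#
  Lentry L = if J ≤ᵇ L then F R x (Lset Λ a b L J) else 0#

  term : ℕ → Carrier
  term t = (Uentry (suc (a ∸ t)) * dval R x Λ a b t) * Lentry (suc (b ∸ t))

module Expansion {ℓ₁ ℓ₂} (R : CommutativeRing ℓ₁ ℓ₂) (x : Cell → CommutativeRing.Carrier R)
  (Λ : List Cell) (yd : IsYoungDiagram Λ) (a b : ℕ) (1≤a : 1 ≤ a) (1≤b : 1 ≤ b)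
  (ab∉Λ : (a , b) ∉ Λ) (border : BorderCond Λ a b)
  (I J : ℕ) (1≤I : 1 ≤ I) (I≤a : I ≤ a) (1≤J : 1 ≤ J) (J≤b : J ≤ b) where

  open CommutativeRing R
    renaming (refl to ≈-refl; sym to ≈-sym; trans to ≈-trans; reflexive to ≈-reflexive)
  open import Relation.Binary.Reasoning.Setoid setoid
  open SplittingSums R x
  open IndexSums R
  open Terms R x Λ a b I J

  S : List Cell
  S = subΛ Λ I J

  S-unique : Unique S
  S-unique = filterᶜ-unique _ Λ (proj₁ yd)

  ∈S⁻ : ∀ {c} → c ∈ S → c ∈ Λ × I ≤ proj₁ c × J ≤ proj₂ c
  ∈S⁻ {c} m = let (c∈Λ , h) = ∈-filterᶜ⁻ _ Λ m ; (I≤u , J≤v) = ∧-elim {I ≤ᵇ proj₁ c} h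
              in c∈Λ , ≤ᵇ⇒≤ _ _ I≤u , ≤ᵇ⇒≤ _ _ J≤v

  ∈S⁺ : ∀ {c} → c ∈ Λ → I ≤ proj₁ c → J ≤ proj₂ c → c ∈ S
  ∈S⁺ {c} c∈Λ I≤u J≤v = ∈-filterᶜ⁺ _ Λ c∈Λ (∧-intro {I ≤ᵇ proj₁ c} (≤⇒≤ᵇ I≤u) (≤⇒≤ᵇ J≤v))

  above leftOf : ℕ → Cell → Bool
  above t c = proj₁ c ≤ᵇ a ∸ t
  leftOf t c = proj₂ c ≤ᵇ b ∸ t

  above↓ : ∀ t → DownClosed (above t)
  above↓ t c' c c'≼c h = ≤⇒≤ᵇ (≤-trans (≼ᵇ-rows c' c c'≼c) (≤ᵇ⇒≤ (proj₁ c) (a ∸ t) h))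

  leftOf↓ : ∀ t → DownClosed (leftOf t)
  leftOf↓ t c' c c'≼c h = ≤⇒≤ᵇ (≤-trans (≼ᵇ-cols c' c c'≼c) (≤ᵇ⇒≤ (proj₂ c) (b ∸ t) h))

  module Q (t : ℕ) = QuadrantSums (above t) (leftOf t) (above↓ t) (leftOf↓ t)

  Φweight : ℕ → Splitting → Carrier
  Φweight t p = if null (Q.SE t (proj₁ p)) ∧ admissible (proj₁ p) (proj₂ p) then Π (proj₂ p) else 0#

  -- Start: SE_1 lies weakly south-east of (a , b) ∉ λ, so it misses S and Φ 1 is F(S).
  F-as-Φ₁ : F R x S ≈ Σs S (Φweight 1)
  F-as-Φ₁ = ≈-trans (F-admissible S S-unique) (Σs-cong-Part S λ {μ} {ν} p →
    ≈-reflexive (≡.cong (λ e → if e ∧ admissible μ ν then Π ν else 0#) (≡.sym (T⇒≡true (SE₁-empty p)))))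
    where
    SE₁-empty : ∀ {μ ν} → Part S μ ν → T (null (Q.SE 1 μ))
    SE₁-empty {μ} p = null⁺ (Q.SE 1 μ) λ {c} m →
      let (c∈μ , ¬above , ¬left) = ∈-filterᶜ²⁻ _ _ μ m
          (c∈Λ , _ , _) = ∈S⁻ (Part-μ⊆S p c∈μ)
          a≤u = ≡.subst (_≤ proj₁ c) (≡.sym (∸-suc 1≤a)) (≤ᵇ-false⇒> _ _ ¬above)
          b≤v = ≡.subst (_≤ proj₂ c) (≡.sym (∸-suc 1≤b)) (≤ᵇ-false⇒> _ _ ¬left)
      in ab∉Λ (proj₂ (proj₂ yd) _ _ a b c∈Λ 1≤a a≤u 1≤b b≤v)

  if-split : ∀ e q e' o (y : Carrier) → (T q → T (not e')) → (T o → T (not q) → T e') → (T e' → T e) →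
    (if e ∧ o then y else 0#) ≈ (if q ∧ e ∧ o then y else 0#) + (if e' ∧ o then y else 0#)
  if-split false true  false _     _ _ _ _ = ≈-sym (+-identityˡ _)
  if-split false false false _     _ _ _ _ = ≈-sym (+-identityˡ _)
  if-split false _     true  _     _ _ _ e'⇒e = ⊥-elim (e'⇒e tt)
  if-split true  true  true  _     _ q⇒¬e' _ _ = ⊥-elim (not-elim (q⇒¬e' tt) tt)
  if-split true  true  false _     _ _ _ _ = ≈-sym (+-identityʳ _)
  if-split true  false true  _     _ _ _ _ = ≈-sym (+-identityˡ _)
  if-split true  false false true  _ _ ¬q⇒e' _ = ⊥-elim (¬q⇒e' tt tt)
  if-split true  false false false _ _ _ _ = ≈-sym (+-identityˡ _)

  SE-shrinks : ∀ t μ → T (null (Q.SE (suc t) μ)) → T (null (Q.SE t μ))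
  SE-shrinks t μ e = null⁺ (Q.SE t μ) λ {c} m →
    let (c∈μ , ¬above , ¬left) = ∈-filterᶜ²⁻ _ _ μ m
    in null⁻ (Q.SE (suc t) μ) e (∈-filterᶜ²⁺ _ _ μ c∈μ
         (≤ᵇ-false-mono (proj₁ c) (∸-monoʳ-≤ a (n≤1+n t)) ¬above)
         (≤ᵇ-false-mono (proj₂ c) (∸-monoʳ-≤ b (n≤1+n t)) ¬left))

  -- One telescoping step, when the corner (a - t , b - t) is a cell of S: the corner
  -- lies in μ, so that μ meets SE_{t+1}, unless ν meets NW_t (quadrant term).
  module CornerStep (t : ℕ) (1≤t : 1 ≤ t) (I≤ : I ≤ a ∸ t) (J≤ : J ≤ b ∸ t) where

    corner : Cell
    corner = a ∸ t , b ∸ t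

    -- The corner is weakly north-west of the border cell's neighbour (a - 1 , b - 1);
    -- the other two border cases would force a - t = 0 or b - t = 0.
    corner∈S : corner ∈ S
    corner∈S = ∈S⁺ (corner∈Λ border) I≤ J≤
      where
      1≤a∸t = ≤-trans 1≤I I≤
      1≤b∸t = ≤-trans 1≤J J≤
      no-room : ∀ {m} → m ≡ 1 → ¬ (1 ≤ m ∸ t)
      no-room refl h = 1+n≰n (≡.subst (1 ≤_) (m≤n⇒m∸n≡0 1≤t) h)
      corner∈Λ : BorderCond Λ a b → corner ∈ Λ
      corner∈Λ (inj₁ nw∈Λ) = proj₂ (proj₂ yd) _ _ _ _ nw∈Λ 1≤a∸t (∸-monoʳ-≤ a 1≤t) 1≤b∸t (∸-monoʳ-≤ b 1≤t)
      corner∈Λ (inj₂ (inj₁ (a≡1 , _))) = ⊥-elim (no-room a≡1 1≤a∸t)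
      corner∈Λ (inj₂ (inj₂ (b≡1 , _))) = ⊥-elim (no-room b≡1 1≤b∸t)

    t<a : t < a
    t<a = ∸-pos⇒< (≤-trans 1≤I I≤)

    t<b : t < b
    t<b = ∸-pos⇒< (≤-trans 1≤J J≤)

    SE-next⁺ : ∀ {μ c} → c ∈ μ → a ∸ t ≤ proj₁ c → b ∸ t ≤ proj₂ c → c ∈ Q.SE (suc t) μ
    SE-next⁺ {μ} {c} c∈μ u≥ v≥ = ∈-filterᶜ²⁺ _ _ μ c∈μ
      (>⇒≤ᵇ-false (proj₁ c) (a ∸ suc t) (≡.subst (_≤ proj₁ c) (∸-suc t<a) u≥))
      (>⇒≤ᵇ-false (proj₂ c) (b ∸ suc t) (≡.subst (_≤ proj₂ c) (∸-suc t<b) v≥))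

    SE-next⁻ : ∀ {μ c} → c ∈ Q.SE (suc t) μ → c ∈ μ × a ∸ t ≤ proj₁ c × b ∸ t ≤ proj₂ c
    SE-next⁻ {μ} {c} m = let (c∈μ , ¬above , ¬left) = ∈-filterᶜ²⁻ _ _ μ m in c∈μ
      , ≡.subst (_≤ proj₁ c) (≡.sym (∸-suc t<a)) (≤ᵇ-false⇒> (proj₁ c) (a ∸ suc t) ¬above)
      , ≡.subst (_≤ proj₂ c) (≡.sym (∸-suc t<b)) (≤ᵇ-false⇒> (proj₂ c) (b ∸ suc t) ¬left)

    corner-in-μ : ∀ {μ ν} → Part S μ ν → T (null (Q.NW t ν)) → T (not (null (Q.SE (suc t) μ)))
    corner-in-μ {μ} {ν} p nw with Part-cover p corner∈S
    ... | inj₁ corner∈μ = nonnull⁺ (SE-next⁺ corner∈μ ≤-refl ≤-refl)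
    ... | inj₂ corner∈ν = ⊥-elim (null⁻ (Q.NW t ν) nw
                             (∈-filterᶜ²⁺ _ _ ν corner∈ν (≤⇒≤ᵇ (≤-refl {a ∸ t})) (≤⇒≤ᵇ (≤-refl {b ∸ t}))))

    -- A cell of NW_t lies weakly north-west of every cell of SE_{t+1}.
    NW-blocks-SE : ∀ {μ ν} → T (admissible μ ν) → T (not (null (Q.NW t ν))) → T (null (Q.SE (suc t) μ))
    NW-blocks-SE {μ} {ν} adm nw≢[] = null⁺ (Q.SE (suc t) μ) λ {c} m →
      let (c' , c'∈NW) = nonnull⁻ (Q.NW t ν) nw≢[]
          (c'∈ν , c'-above , c'-left) = ∈-filterᶜ²⁻ _ _ ν c'∈NW
          (c∈μ , u≥ , v≥) = SE-next⁻ m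
      in admissible-elim μ ν adm c∈μ c'∈ν (≼ᵇ-intro c' c
           (≤-trans (≤ᵇ⇒≤ (proj₁ c') (a ∸ t) c'-above) u≥) (≤-trans (≤ᵇ⇒≤ (proj₂ c') (b ∸ t) c'-left) v≥))

    Φ-step : Σs S (Φweight t) ≈ Σs S (Q.quadrantWeight t) + Σs S (Φweight (suc t))
    Φ-step = ≈-trans
      (Σs-cong-Part S λ {μ} {ν} p → if-split (null (Q.SE t μ)) (null (Q.NW t ν)) (null (Q.SE (suc t) μ))
                                       (admissible μ ν) (Π ν) (corner-in-μ p) (NW-blocks-SE {μ} {ν}) (SE-shrinks t μ))
      (sumR-+ _ _ (splits S))

  -- Without the corner, NW_t misses S and Φ t is just the quadrant term.
  Φ-last : ∀ t → ¬ (I ≤ a ∸ t × J ≤ b ∸ t) → Σs S (Φweight t) ≈ Σs S (Q.quadrantWeight t)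
  Φ-last t ¬corner = Σs-cong-Part S λ {μ} {ν} p →
    ≈-reflexive (≡.cong (λ q → if q ∧ null (Q.SE t μ) ∧ admissible μ ν then Π ν else 0#) (≡.sym (T⇒≡true (NW-empty p))))
    where
    NW-empty : ∀ {μ ν} → Part S μ ν → T (null (Q.NW t ν))
    NW-empty {μ} {ν} p = null⁺ (Q.NW t ν) λ {c} m →
      let (c∈ν , above-c , left-c) = ∈-filterᶜ²⁻ _ _ ν m
          (_ , I≤u , J≤v) = ∈S⁻ (Part-ν⊆S p c∈ν)
      in ¬corner (≤-trans I≤u (≤ᵇ⇒≤ (proj₁ c) (a ∸ t) above-c) , ≤-trans J≤v (≤ᵇ⇒≤ (proj₂ c) (b ∸ t) left-c))

  module AtCorner (t : ℕ) (t≤a : t ≤ a) (t≤b : t ≤ b) (I≤K : I ≤ suc (a ∸ t)) (J≤L : J ≤ suc (b ∸ t)) where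

    K L : ℕ
    K = suc (a ∸ t)
    L = suc (b ∸ t)

    NE-S : Q.NE t S ≡ Uset Λ a b I K
    NE-S = ≡.trans (filterᶜ³ _ _ _ Λ) (filterᶜ-cong _ _ Λ to from)
      where
      to : ∀ c → T (((I ≤ᵇ proj₁ c) ∧ (J ≤ᵇ proj₂ c)) ∧ (above t c ∧ ∁ (leftOf t) c)) →
           T ((I ≤ᵇ proj₁ c) ∧ (suc (proj₁ c) ≤ᵇ K) ∧ (K ℕ.+ b ≤ᵇ proj₂ c ℕ.+ a))
      to (u , v) h = let (I≤u , _ , u≤ , ¬v≤) = ∧⁴-elim {I ≤ᵇ u} h in
        ∧³-intro {I ≤ᵇ u} I≤u (≤⇒≤ᵇ (s≤s (≤ᵇ⇒≤ u (a ∸ t) u≤)))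
          (≤⇒≤ᵇ (Equivalence.from (diagonal-≤ v t≤a t≤b) (≤ᵇ-false⇒> v (b ∸ t) ¬v≤)))
      from : ∀ c → T ((I ≤ᵇ proj₁ c) ∧ (suc (proj₁ c) ≤ᵇ K) ∧ (K ℕ.+ b ≤ᵇ proj₂ c ℕ.+ a)) →
             T (((I ≤ᵇ proj₁ c) ∧ (J ≤ᵇ proj₂ c)) ∧ (above t c ∧ ∁ (leftOf t) c))
      from (u , v) h = let (I≤u , u<K , diag) = ∧³-elim {I ≤ᵇ u} h
                           L≤v = Equivalence.to (diagonal-≤ v t≤a t≤b) (≤ᵇ⇒≤ (K ℕ.+ b) (v ℕ.+ a) diag) in
        ∧⁴-intro {I ≤ᵇ u} I≤u (≤⇒≤ᵇ (≤-trans J≤L L≤v)) (≤⇒≤ᵇ (≤-pred (≤ᵇ⇒≤ (suc u) K u<K))) (>⇒≤ᵇ-false v (b ∸ t) L≤v)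

    SW-S : Q.SW t S ≡ Lset Λ a b L J
    SW-S = ≡.trans (filterᶜ³ _ _ _ Λ) (filterᶜ-cong _ _ Λ to from)
      where
      to : ∀ c → T (((I ≤ᵇ proj₁ c) ∧ (J ≤ᵇ proj₂ c)) ∧ (∁ (above t) c ∧ leftOf t c)) →
           T ((J ≤ᵇ proj₂ c) ∧ (suc (proj₂ c) ≤ᵇ L) ∧ (L ℕ.+ a ≤ᵇ proj₁ c ℕ.+ b))
      to (u , v) h = let (_ , J≤v , ¬u≤ , v≤) = ∧⁴-elim {I ≤ᵇ u} h in
        ∧³-intro {J ≤ᵇ v} J≤v (≤⇒≤ᵇ (s≤s (≤ᵇ⇒≤ v (b ∸ t) v≤)))
          (≤⇒≤ᵇ (Equivalence.from (diagonal-≤ u t≤b t≤a) (≤ᵇ-false⇒> u (a ∸ t) ¬u≤)))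
      from : ∀ c → T ((J ≤ᵇ proj₂ c) ∧ (suc (proj₂ c) ≤ᵇ L) ∧ (L ℕ.+ a ≤ᵇ proj₁ c ℕ.+ b)) →
             T (((I ≤ᵇ proj₁ c) ∧ (J ≤ᵇ proj₂ c)) ∧ (∁ (above t) c ∧ leftOf t c))
      from (u , v) h = let (J≤v , v<L , diag) = ∧³-elim {J ≤ᵇ v} h
                           K≤u = Equivalence.to (diagonal-≤ u t≤b t≤a) (≤ᵇ⇒≤ (L ℕ.+ a) (u ℕ.+ b) diag) in
        ∧⁴-intro {I ≤ᵇ u} (≤⇒≤ᵇ (≤-trans I≤K K≤u)) J≤v (>⇒≤ᵇ-false u (a ∸ t) K≤u) (≤⇒≤ᵇ (≤-pred (≤ᵇ⇒≤ (suc v) L v<L)))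

    SE-S : Q.SE t S ≡ subΛ Λ K L
    SE-S = ≡.trans (filterᶜ³ _ _ _ Λ) (filterᶜ-cong _ _ Λ to from)
      where
      to : ∀ c → T (((I ≤ᵇ proj₁ c) ∧ (J ≤ᵇ proj₂ c)) ∧ (∁ (above t) c ∧ ∁ (leftOf t) c)) →
           T ((K ≤ᵇ proj₁ c) ∧ (L ≤ᵇ proj₂ c))
      to (u , v) h = let (_ , _ , ¬u≤ , ¬v≤) = ∧⁴-elim {I ≤ᵇ u} h in
        ∧-intro {K ≤ᵇ u} (≤⇒≤ᵇ (≤ᵇ-false⇒> u (a ∸ t) ¬u≤)) (≤⇒≤ᵇ (≤ᵇ-false⇒> v (b ∸ t) ¬v≤))
      from : ∀ c → T ((K ≤ᵇ proj₁ c) ∧ (L ≤ᵇ proj₂ c)) →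
             T (((I ≤ᵇ proj₁ c) ∧ (J ≤ᵇ proj₂ c)) ∧ (∁ (above t) c ∧ ∁ (leftOf t) c))
      from (u , v) h = let (K≤u , L≤v) = ∧-elim {K ≤ᵇ u} h ; K≤u = ≤ᵇ⇒≤ K u K≤u ; L≤v = ≤ᵇ⇒≤ L v L≤v in
        ∧⁴-intro {I ≤ᵇ u} (≤⇒≤ᵇ (≤-trans I≤K K≤u)) (≤⇒≤ᵇ (≤-trans J≤L L≤v))
          (>⇒≤ᵇ-false u (a ∸ t) K≤u) (>⇒≤ᵇ-false v (b ∸ t) L≤v)

    Ψ≈term : Σs S (Q.quadrantWeight t) ≈ term t
    Ψ≈term = begin
      Σs S (Q.quadrantWeight t)                                ≈⟨ Q.quadrant-factorisation t S S-unique ⟩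
      F R x (Q.NE t S) * (F R x (Q.SW t S) * Π (Q.SE t S))    ≡⟨ ≡.cong₂ (λ A B → F R x A * B) NE-S
                                                                    (≡.cong₂ (λ A B → F R x A * Π B) SW-S SE-S) ⟩
      FU * (FL * d)                                            ≈⟨ *-congˡ (*-comm _ _) ⟩
      FU * (d * FL)                                            ≈⟨ *-assoc _ _ _ ⟨
      (FU * d) * FL                                            ≡⟨ ≡.cong₂ (λ U V → (U * d) * V) (if-T (≤⇒≤ᵇ I≤K)) (if-T (≤⇒≤ᵇ J≤L)) ⟨
      term t                                                   ∎
      where
      FU = F R x (Uset Λ a b I K)
      FL = F R x (Lset Λ a b L J)
      d = dval R x Λ a b t

  -- Terms past a missing corner vanish: (I , J) is not weakly north-west of their (K , L).
  term-vanishes : ∀ {t r} → t < r → r ≤ a → r ≤ b → ¬ (I ≤ a ∸ t × J ≤ b ∸ t) → term r ≈ 0#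
  term-vanishes {t} {r} t<r r≤a r≤b ¬corner with T-cases (I ≤ᵇ suc (a ∸ r)) | T-cases (J ≤ᵇ suc (b ∸ r))
  ... | inj₁ I≤K | inj₁ J≤L = ⊥-elim (¬corner (≤-trans (≤ᵇ⇒≤ I _ I≤K) (∸-step t<r r≤a) , ≤-trans (≤ᵇ⇒≤ J _ J≤L) (∸-step t<r r≤b)))
  ... | inj₂ I>K | _ rewrite T-not⇒≡false I>K = ≈-trans (*-congʳ (zeroˡ _)) (zeroˡ _)
  ... | inj₁ _ | inj₂ J>L rewrite T-not⇒≡false J>L = zeroʳ _

  ⊓-bounds : ∀ {r} → r ≤ a ⊓ b → r ≤ a × r ≤ b
  ⊓-bounds r≤c = m≤n⊓o⇒m≤n a b r≤c , m≤n⊓o⇒m≤o a b r≤c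

  Φ-telescope : ∀ n t → t ℕ.+ n ≡ a ⊓ b → 1 ≤ t → I ≤ suc (a ∸ t) → J ≤ suc (b ∸ t) →
                Σs S (Φweight t) ≈ ∑< (suc n) (λ k → term (t ℕ.+ k))

  Φ-no-corner : ∀ n t → t ℕ.+ n ≡ a ⊓ b → I ≤ suc (a ∸ t) → J ≤ suc (b ∸ t) → ¬ (I ≤ a ∸ t × J ≤ b ∸ t) →
                Σs S (Φweight t) ≈ ∑< (suc n) (λ k → term (t ℕ.+ k))
  Φ-no-corner n t t+n≡c I≤K J≤L ¬corner = begin
    Σs S (Φweight t)                                  ≈⟨ Φ-last t ¬corner ⟩
    Σs S (Q.quadrantWeight t)                         ≈⟨ AtCorner.Ψ≈term t (proj₁ (⊓-bounds t≤c)) (proj₂ (⊓-bounds t≤c)) I≤K J≤L ⟩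
    term t                                            ≈⟨ +-identityʳ _ ⟨
    term t + 0#                                       ≈⟨ +-cong (≈-reflexive (≡.cong term (ℕₚ.+-identityʳ t))) (∑<-zero n later-vanish) ⟨
    term (t ℕ.+ 0) + ∑< n (λ k → term (t ℕ.+ suc k))  ∎
    where
    t≤c : t ≤ a ⊓ b
    t≤c = ≡.subst (t ≤_) t+n≡c (ℕₚ.m≤m+n t n)
    later-vanish : ∀ k → k < n → term (t ℕ.+ suc k) ≈ 0#
    later-vanish k k<n = let r≤c = ≡.subst (t ℕ.+ suc k ≤_) t+n≡c (ℕₚ.+-monoʳ-≤ t k<n) in
      term-vanishes (ℕₚ.m<m+n t (s≤s z≤n)) (proj₁ (⊓-bounds r≤c)) (proj₂ (⊓-bounds r≤c)) ¬corner

  Φ-corner : ∀ n t → t ℕ.+ n ≡ a ⊓ b → 1 ≤ t → I ≤ a ∸ t → J ≤ b ∸ t →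
             Σs S (Φweight t) ≈ ∑< (suc n) (λ k → term (t ℕ.+ k))
  Φ-corner zero t t+0≡c 1≤t I≤ J≤ = ⊥-elim (1+n≰n (≡.subst (suc t ≤_) t+0=t (⊓-glb t<a t<b)))
    where
    open CornerStep t 1≤t I≤ J≤ using (t<a; t<b)
    t+0=t : a ⊓ b ≡ t
    t+0=t = ≡.trans (≡.sym t+0≡c) (ℕₚ.+-identityʳ t)
  Φ-corner (suc n) t t+n≡c 1≤t I≤ J≤ = begin
    Σs S (Φweight t)                                    ≈⟨ Φ-step ⟩
    Σs S (Q.quadrantWeight t) + Σs S (Φweight (suc t))  ≈⟨ +-cong (AtCorner.Ψ≈term t (<⇒≤ t<a) (<⇒≤ t<b) (ℕₚ.m≤n⇒m≤1+n I≤) (ℕₚ.m≤n⇒m≤1+n J≤))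
                                                             (Φ-telescope n (suc t) (≡.trans (≡.sym (ℕₚ.+-suc t n)) t+n≡c) (s≤s z≤n)
                                                               (≡.subst (I ≤_) (∸-suc t<a) I≤) (≡.subst (J ≤_) (∸-suc t<b) J≤)) ⟩
    term t + ∑< (suc n) (λ k → term (suc t ℕ.+ k))      ≈⟨ +-cong (≈-reflexive (≡.cong term (ℕₚ.+-identityʳ t)))
                                                             (∑<-cong (suc n) λ k _ → ≈-reflexive (≡.cong term (ℕₚ.+-suc t k))) ⟨
    ∑< (suc (suc n)) (λ k → term (t ℕ.+ k))             ∎
    where open CornerStep t 1≤t I≤ J≤ using (t<a; t<b; Φ-step)

  Φ-telescope n t t+n≡c 1≤t I≤K J≤L with I ≤? a ∸ t | J ≤? b ∸ t
  ... | yes I≤ | yes J≤ = Φ-corner n t t+n≡c 1≤t I≤ J≤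
  ... | no I≰ | _ = Φ-no-corner n t t+n≡c I≤K J≤L (I≰ ∘ proj₁)
  ... | yes _ | no J≰ = Φ-no-corner n t t+n≡c I≤K J≤L (J≰ ∘ proj₂)

  F-expansion : F R x S ≈ ∑< (a ⊓ b) (λ r → term (suc r))
  F-expansion = begin
    F R x S                                     ≈⟨ F-as-Φ₁ ⟩
    Σs S (Φweight 1)                            ≈⟨ Φ-telescope (a ⊓ b ∸ 1) 1 (≡.sym c≡1+) (s≤s z≤n)
                                                     (≡.subst (I ≤_) (∸-suc 1≤a) I≤a) (≡.subst (J ≤_) (∸-suc 1≤b) J≤b) ⟩
    ∑< (suc (a ⊓ b ∸ 1)) (λ k → term (suc k))   ≡⟨ ≡.cong (λ n → ∑< n (λ k → term (suc k))) c≡1+ ⟨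
    ∑< (a ⊓ b) (λ r → term (suc r))             ∎
    where
    c≡1+ : a ⊓ b ≡ suc (a ⊓ b ∸ 1)
    c≡1+ = ∸-suc (⊓-glb 1≤a 1≤b)

-- The product side: D is supported on the c = min(a , b) diagonal cells
-- (a - r , b - r), so (UDL)_{IJ} collapses to Σ_{r < c} term (r + 1).
module Product {ℓ₁ ℓ₂} (R : CommutativeRing ℓ₁ ℓ₂) (x : Cell → CommutativeRing.Carrier R)
  (Λ : List Cell) (a b I J : ℕ) where

  open CommutativeRing R
    renaming (refl to ≈-refl; sym to ≈-sym; trans to ≈-trans; reflexive to ≈-reflexive)
  open import Relation.Binary.Reasoning.Setoid setoid
  open IndexSums R
  open Terms R x Λ a b I J

  δ : ℕ → ℕ → ℕ → Carrier
  δ r K L = if (K ≡ᵇ suc (a ∸ suc r)) ∧ (L ≡ᵇ suc (b ∸ suc r)) then dval R x Λ a b (suc r) else 0#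

  findDiag-sound : ∀ K L n {i} → findDiag a b K L n ≡ just i → i ≤ n × K ≡ suc (a ∸ i)
  findDiag-sound K L (suc n) eq with findDiag a b K L n in eq₀
  ... | just _ with eq
  ...   | refl = let (i≤n , K≡) = findDiag-sound K L n eq₀ in ℕₚ.m≤n⇒m≤1+n i≤n , K≡
  findDiag-sound K L (suc n) eq | nothing with T-cases ((K ≡ᵇ suc (a ∸ suc n)) ∧ (L ≡ᵇ suc (b ∸ suc n)))
  ... | inj₁ hit rewrite T⇒≡true hit with eq
  ...   | refl = ≤-refl , ≡ᵇ⇒≡ K _ (proj₁ (∧-elim {K ≡ᵇ suc (a ∸ suc n)} hit))
  findDiag-sound K L (suc n) eq | nothing | inj₂ miss rewrite T-not⇒≡false miss with eq
  ... | ()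

  -- Distinct diagonal cells lie in distinct rows.
  δ-after-hit : ∀ {K L n i} → suc n ≤ a → i ≤ n → K ≡ suc (a ∸ i) → δ n K L ≈ 0#
  δ-after-hit {K} {L} {n} {i} n<a i≤n K≡ with T-cases ((K ≡ᵇ suc (a ∸ suc n)) ∧ (L ≡ᵇ suc (b ∸ suc n)))
  ... | inj₁ hit = ⊥-elim (1+n≰n (≡.subst (_≤ a ∸ i) (≡.trans (≡.sym K≡') K≡) (∸-step (s≤s i≤n) n<a)))
    where
    K≡' : K ≡ suc (a ∸ suc n)
    K≡' = ≡ᵇ⇒≡ K _ (proj₁ (∧-elim {K ≡ᵇ suc (a ∸ suc n)} hit))
  ... | inj₂ miss rewrite T-not⇒≡false miss = ≈-refl

  findDiag-as-sum : ∀ K L n → n ≤ a → maybe (dval R x Λ a b) 0# (findDiag a b K L n) ≈ ∑< n (λ r → δ r K L)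
  findDiag-as-sum K L zero _ = ≈-refl
  findDiag-as-sum K L (suc n) n<a with findDiag a b K L n in eq₀ | findDiag-as-sum K L n (<⇒≤ n<a)
  ... | just i | ih = begin
    dval R x Λ a b i              ≈⟨ ih ⟩
    ∑< n δKL                      ≈⟨ +-identityʳ _ ⟨
    ∑< n δKL + 0#                 ≈⟨ +-congˡ (δ-after-hit {L = L} n<a i≤n K≡) ⟨
    ∑< n δKL + δ n K L            ≈⟨ ∑<-snoc n δKL ⟨
    ∑< (suc n) δKL                ∎
    where
    δKL = λ r → δ r K L
    i≤n = proj₁ (findDiag-sound K L n eq₀)
    K≡ = proj₂ (findDiag-sound K L n eq₀)
  ... | nothing | ih = begin
    maybe (dval R x Λ a b) 0# (if hit then just (suc n) else nothing) ≡⟨ maybe-if (dval R x Λ a b) 0# hit (suc n) ⟩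
    δ n K L                       ≈⟨ +-identityˡ _ ⟨
    0# + δ n K L                  ≈⟨ +-congʳ ih ⟩
    ∑< n δKL + δ n K L            ≈⟨ ∑<-snoc n δKL ⟨
    ∑< (suc n) δKL                ∎
    where
    δKL = λ r → δ r K L
    hit = (K ≡ᵇ suc (a ∸ suc n)) ∧ (L ≡ᵇ suc (b ∸ suc n))

  Dentry : ℕ → ℕ → Carrier
  Dentry K L = maybe (dval R x Λ a b) 0# (findDiag a b K L (a ⊓ b))

  guarded-product : ∀ p q (u d v : Carrier) →
    (u * (if p ∧ q then d else 0#)) * v ≈ (if p then (if q then (u * d) * v else 0#) else 0#)
  guarded-product true true u d v = ≈-refl
  guarded-product true false u d v = ≈-trans (*-congʳ (zeroʳ _)) (zeroˡ _)
  guarded-product false q u d v = ≈-trans (*-congʳ (zeroʳ _)) (zeroˡ _)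

  UDL-collapse : ∑< a (λ k → ∑< b (λ l → (Uentry (suc k) * Dentry (suc k) (suc l)) * Lentry (suc l)))
                 ≈ ∑< (a ⊓ b) (λ r → term (suc r))
  UDL-collapse = begin
    ∑< a (λ k → ∑< b (λ l → (Uentry (suc k) * Dentry (suc k) (suc l)) * Lentry (suc l)))
      ≈⟨ ∑<-cong a (λ k _ → ∑<-cong b (λ l _ → expand-D k l)) ⟩
    ∑< a (λ k → ∑< b (λ l → ∑< (a ⊓ b) (f k l)))
      ≈⟨ ∑<-cong a (λ k _ → ∑<-comm b (a ⊓ b) (f k)) ⟩
    ∑< a (λ k → ∑< (a ⊓ b) (λ r → ∑< b (λ l → f k l r)))
      ≈⟨ ∑<-comm a (a ⊓ b) (λ k r → ∑< b (λ l → f k l r)) ⟩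
    ∑< (a ⊓ b) (λ r → ∑< a (λ k → ∑< b (λ l → f k l r)))
      ≈⟨ ∑<-cong (a ⊓ b) collapse ⟩
    ∑< (a ⊓ b) (λ r → term (suc r)) ∎
    where
    f : ℕ → ℕ → ℕ → Carrier
    f k l r = (Uentry (suc k) * δ r (suc k) (suc l)) * Lentry (suc l)

    expand-D : ∀ k l → (Uentry (suc k) * Dentry (suc k) (suc l)) * Lentry (suc l) ≈ ∑< (a ⊓ b) (f k l)
    expand-D k l = begin
      (Uentry (suc k) * Dentry (suc k) (suc l)) * Lentry (suc l)
        ≈⟨ *-congʳ (*-congˡ (findDiag-as-sum (suc k) (suc l) (a ⊓ b) (ℕₚ.m⊓n≤m a b))) ⟩
      (Uentry (suc k) * ∑< (a ⊓ b) (λ r → δ r (suc k) (suc l))) * Lentry (suc l)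
        ≈⟨ *-congʳ (∑<-*ˡ (a ⊓ b) (Uentry (suc k)) (λ r → δ r (suc k) (suc l))) ⟩
      ∑< (a ⊓ b) (λ r → Uentry (suc k) * δ r (suc k) (suc l)) * Lentry (suc l)
        ≈⟨ ∑<-*ʳ (a ⊓ b) (Lentry (suc l)) (λ r → Uentry (suc k) * δ r (suc k) (suc l)) ⟩
      ∑< (a ⊓ b) (f k l) ∎

    -- for fixed r only (k , l) = (a - r - 1 , b - r - 1) survives
    collapse : ∀ r → r < a ⊓ b → ∑< a (λ k → ∑< b (λ l → f k l r)) ≈ term (suc r)
    collapse r r<c = begin
      ∑< a (λ k → ∑< b (λ l → f k l r))
        ≈⟨ ∑<-cong a (λ k _ → ∑<-cong b (λ l _ → guarded-product (k ≡ᵇ a ∸ suc r) (l ≡ᵇ b ∸ suc r)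
                                                     (Uentry (suc k)) (dval R x Λ a b (suc r)) (Lentry (suc l)))) ⟩
      ∑< a (λ k → ∑< b (λ l → if k ≡ᵇ a ∸ suc r then g k l else 0#))
        ≈⟨ ∑<-cong a (λ k _ → ∑<-if b (k ≡ᵇ a ∸ suc r) (g k)) ⟩
      ∑< a (λ k → if k ≡ᵇ a ∸ suc r then ∑< b (g k) else 0#)
        ≈⟨ ∑<-δ a (λ k → ∑< b (g k)) (a ∸ suc r) (ℕₚ.∸-monoʳ-< (s≤s z≤n) (m≤n⊓o⇒m≤n a b r<c)) ⟩
      ∑< b (g (a ∸ suc r))
        ≈⟨ ∑<-δ b (λ l → (Uentry (suc (a ∸ suc r)) * dval R x Λ a b (suc r)) * Lentry (suc l)) (b ∸ suc r) (ℕₚ.∸-monoʳ-< (s≤s z≤n) (m≤n⊓o⇒m≤o a b r<c)) ⟩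
      term (suc r) ∎
      where
      g : ℕ → ℕ → Carrier
      g k l = if l ≡ᵇ b ∸ suc r then (Uentry (suc k) * dval R x Λ a b (suc r)) * Lentry (suc l) else 0#

theorem5p4 : ∀ {c ℓ : Level} (R : CommutativeRing c ℓ) (x : Cell → CommutativeRing.Carrier R)
    (Λ : List Cell) → IsYoungDiagram Λ → Λ ≢ [] →
    (a b : ℕ) → 1 ≤ a → 1 ≤ b → (a , b) ∉ Λ → BorderCond Λ a b →
    (i : Fin a) (j : Fin b) →
    CommutativeRing._≈_ R (Amat R x Λ a b i j) (UDL R x Λ a b i j)
theorem5p4 R x Λ yd _ a b 1≤a 1≤b ab∉Λ border i j = begin
  Amat R x Λ a b i j                           ≈⟨ F-expansion ⟩
  ∑< (a ⊓ b) (λ r → term (suc r))              ≈⟨ UDL-collapse ⟨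
  ∑< a (λ k → ∑< b (λ l → UDL-summand k l))    ≡⟨ sumFin²≡∑<² a b UDL-summand ⟨
  UDL R x Λ a b i j                            ∎
  where
  open CommutativeRing R using (Carrier; _*_; setoid)
  open import Relation.Binary.Reasoning.Setoid setoid
  open IndexSums R using (∑<; sumFin²≡∑<²)
  open Terms R x Λ a b (idx i) (idx j) using (Uentry; Lentry; term)
  open Expansion R x Λ yd a b 1≤a 1≤b ab∉Λ border (idx i) (idx j) (s≤s z≤n) (toℕ<n i) (s≤s z≤n) (toℕ<n j)
    using (F-expansion)
  open Product R x Λ a b (idx i) (idx j) using (Dentry; UDL-collapse)

  UDL-summand : ℕ → ℕ → Carrier
  UDL-summand k l = (Uentry (suc k) * Dentry (suc k) (suc l)) * Lentry (suc l)
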